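{- Let $m\in\mathcal{M}_N$ be a matching with $\mathrm{Short}(m)=\emptyset$, and let $N',f'\ge0$. Then the set $\mathcal{M}_{N',f'}(m)$ of matchings in $\mathcal{M}_{N',f'}$ avoiding $m$ is closed under Knuth-like equivalence.
   Context: A matching on a finite set $S\subseteq\mathbb{N}$ is a partition of $S$ into blocks of size 1 (unmatched vertex $(i)$) or 2 (chord $(i,j)$). $\mathcal{M}_N$ is the set of matchings on $[N]$, $\mathcal{M}_{N,f}$ those with exactly $f$ unmatched vertices; $\mathrm{Short}(m)=\{i\in[N-1]\mid (i,i+1)\text{ is a chord of }m\}$. For $m_1\in\mathcal{M}_{N_1}$, $m_2\in\mathcal{M}_{N_2}$, $m_2$ contains the pattern $m_1$ if there are $1\le i_1<\dots<i_{N_1}\le N_2$ with: for all $1\le j<j'\le N_1$, $(j,j')$ is a chord of $m_1$ iff $(i_j,i_{j'})$ is a chord of $m_2$; and for all $j$, $(j)$ is unmatched in $m_1$ iff $(i_j)$ is unmatched in $m_2$. Otherwise $m_2$ avoids $m_1$. Elementary Knuth-like transformations: (a) replace $(i,i+1),(i+2)$ by $(i),(i+1,i+2)$ or vice versa; (b) replace chords $(i,i+1),(i+2,j)$ (any $j$) by $(i,j),(i+1,i+2)$ or vice versa. Knuth-like equivalence is the equivalence relation generated by them. -}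

module Defs where

open import Data.Nat using (ℕ; suc)
open import Data.Fin using (Fin; toℕ; _<_)
open import Data.Fin.Properties using (_≟_)
open import Data.List using (List; length; filter)
open import Data.List.Base using (allFin)
open import Data.Product using (Σ; _×_; ∃-syntax)
open import Data.Sum using (_⊎_)
open import Relation.Nullary using (¬_)
open import Relation.Binary.PropositionalEquality using (_≡_; _≢_)
open import Relation.Binary.Construct.Closure.Equivalence using (EqClosure)
open import Function.Bundles using (_⇔_)

-- A matching on [N] (positions encoded 0-based as Fin N) is encoded by its
-- partner involution: p i ≡ i  means (i) is an unmatched vertex,
-- p i ≡ j with j ≢ i means (i,j) is a chord.  Partitions of [N] into blocks
-- of size 1 or 2 are in bijection with such involutions.
record Matching (N : ℕ) : Set where
  constructor mkMatching
  field
    partner : Fin N → Fin N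
    invol   : ∀ i → partner (partner i) ≡ i
open Matching public

IsChord : ∀ {N} → Matching N → Fin N → Fin N → Set
IsChord m i j = (partner m i ≡ j) × (i ≢ j)

IsUnmatched : ∀ {N} → Matching N → Fin N → Set
IsUnmatched m i = partner m i ≡ i

numUnmatched : ∀ {N} → Matching N → ℕ
numUnmatched {N} m = length (filter (λ i → partner m i ≟ i) (allFin N))

HasUnmatched : ∀ {N} → ℕ → Matching N → Set
HasUnmatched f m = numUnmatched m ≡ f

ShortEmpty : ∀ {N} → Matching N → Set
ShortEmpty {N} m = ∀ (i j : Fin N) → toℕ j ≡ suc (toℕ i) → ¬ IsChord m i j

Contains : ∀ {N₁ N₂} → Matching N₂ → Matching N₁ → Set
Contains {N₁} {N₂} m₂ m₁ =
  Σ (Fin N₁ → Fin N₂) λ e →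
    (∀ j j' → j < j' → e j < e j')
    × (∀ j j' → j < j' → IsChord m₁ j j' ⇔ IsChord m₂ (e j) (e j'))
    × (∀ j → IsUnmatched m₁ j ⇔ IsUnmatched m₂ (e j))

Avoids : ∀ {N₁ N₂} → Matching N₂ → Matching N₁ → Set
Avoids m₂ m₁ = ¬ Contains m₂ m₁

KnuthA : ∀ {N} → Matching N → Matching N → Set
KnuthA {N} m m' =
  ∃[ i ] ∃[ i₁ ] ∃[ i₂ ]
    (toℕ i₁ ≡ suc (toℕ i)) × (toℕ i₂ ≡ suc (toℕ i₁))
    × IsChord m i i₁ × IsUnmatched m i₂
    × IsUnmatched m' i × IsChord m' i₁ i₂
    × (∀ k → k ≢ i → k ≢ i₁ → k ≢ i₂ → partner m' k ≡ partner m k)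

KnuthB : ∀ {N} → Matching N → Matching N → Set
KnuthB {N} m m' =
  ∃[ i ] ∃[ i₁ ] ∃[ i₂ ] ∃[ j ]
    (toℕ i₁ ≡ suc (toℕ i)) × (toℕ i₂ ≡ suc (toℕ i₁))
    × IsChord m i i₁ × IsChord m i₂ j
    × IsChord m' i j × IsChord m' i₁ i₂
    × (∀ k → k ≢ i → k ≢ i₁ → k ≢ i₂ → k ≢ j → partner m' k ≡ partner m k)

KnuthStep : ∀ {N} → Matching N → Matching N → Set
KnuthStep m m' = KnuthA m m' ⊎ KnuthA m' m ⊎ KnuthB m m' ⊎ KnuthB m' m

KnuthEquiv : ∀ {N} → Matching N → Matching N → Set
KnuthEquiv = EqClosure KnuthStep

InAvoidSet : ∀ {N N'} → Matching N → ℕ → Matching N' → Set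
InAvoidSet m f' m' = HasUnmatched f' m' × Avoids m' m

-- Each elementary Knuth-like move conjugates the matching by the transposition (a a+2) of the
-- ends of a window a, a+1, a+2 whose middle vertex is matched inside the window. Conjugation
-- by a permutation preserves the number of unmatched vertices and carries an occurrence of a
-- pattern to an occurrence whenever the permutation is increasing on it. An occurrence of a
-- pattern without short chords avoids every vertex lying on a short chord, hence avoids a+1
-- and its partner (a or a+2), and on the remaining points the transposition is increasing.
module Submission where

open import Defs
open import Data.Nat as ℕ using (ℕ; zero; suc)
import Data.Nat.Properties as ℕ
open import Data.Fin using (Fin; toℕ; fromℕ<; _<_; _≤_)
open import Data.Fin.Properties using (_≟_; ≤∧≢⇒<; <-cmp; toℕ<n; toℕ-fromℕ<)
open import Data.Fin.Permutation using (Permutation′; _⟨$⟩ʳ_; _⟨$⟩ˡ_; inverseˡ)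
import Data.Fin.Permutation as Permutation
open import Data.Fin.Permutation.Components using (transpose)
open import Data.List using (length; filter; tabulate)
open import Data.Bool using (if_then_else_; true; false)
open import Data.Product using (_×_; _,_; proj₁)
open import Data.Sum using (_⊎_; inj₁; inj₂)
open import Data.Empty using (⊥-elim)
open import Function using (id; _∘_)
open import Function.Bundles using (_⇔_; mk⇔; Equivalence)
open import Function.Definitions using (Injective)
open import Function.Properties.Equivalence using (⇔-isEquivalence)
open import Function.Construct.Composition using (_⇔-∘_)
open import Relation.Nullary using (Dec; yes; no; does; ¬_)
open import Relation.Nullary.Decidable using (dec-true; dec-false)
open import Relation.Unary using (Decidable)
open import Relation.Binary.Definitions using (tri<; tri≈; tri>)
open import Relation.Binary.PropositionalEquality
open import Relation.Binary.Construct.Closure.Equivalence using (gfold)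
open import Algebra.Properties.CommutativeMonoid.Sum ℕ.+-0-commutativeMonoid
  using (sum; sum-permute; sum-cong-≗)

private
  variable
    K N : ℕ

transpose-left : (a b : Fin N) → transpose a b a ≡ b
transpose-left a b rewrite dec-true (a ≟ a) refl = refl

transpose-right : (a b : Fin N) → transpose a b b ≡ a
transpose-right a b with b ≟ a
... | yes b≡a = b≡a
... | no _ rewrite dec-true (b ≟ b) refl = refl

transpose-other : (a b : Fin N) {x : Fin N} → x ≢ a → x ≢ b → transpose a b x ≡ x
transpose-other a b {x} x≢a x≢b rewrite dec-false (x ≟ a) x≢a | dec-false (x ≟ b) x≢b = refl

data TransposeView (a b x : Fin N) : Set where
  at-left  : x ≡ a → transpose a b x ≡ b → TransposeView a b x
  at-right : x ≡ b → transpose a b x ≡ a → TransposeView a b x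
  fixed    : x ≢ a → x ≢ b → transpose a b x ≡ x → TransposeView a b x

transpose-view : (a b x : Fin N) → TransposeView a b x
transpose-view a b x with x ≟ a | x ≟ b
... | yes refl | _      = at-left refl (transpose-left a b)
... | no _     | yes refl = at-right refl (transpose-right a b)
... | no x≢a   | no x≢b = fixed x≢a x≢b (transpose-other a b x≢a x≢b)

transpose-involutive : (a b x : Fin N) → transpose a b (transpose a b x) ≡ x
transpose-involutive a b x with transpose-view a b x
... | at-left refl τx  = trans (cong (transpose a b) τx) (transpose-right a b)
... | at-right refl τx = trans (cong (transpose a b) τx) (transpose-left a b)
... | fixed _ _ τx     = trans (cong (transpose a b) τx) τx

involutive⇒injective : {σ : Fin N → Fin N} → (∀ x → σ (σ x) ≡ x) → Injective _≡_ _≡_ σ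
involutive⇒injective {σ = σ} σσ {x} {y} σx≡σy = trans (sym (σσ x)) (trans (cong σ σx≡σy) (σσ y))

Adjacent : Fin N → Fin N → Set
Adjacent x y = toℕ y ≡ suc (toℕ x)

adjacent⇒< : {x y : Fin N} → Adjacent x y → x < y
adjacent⇒< x⋖y = ℕ.≤-reflexive (sym x⋖y)

adjacent⇒≢ : {x y : Fin N} → Adjacent x y → x ≢ y
adjacent⇒≢ x⋖y refl = ℕ.<-irrefl refl (adjacent⇒< x⋖y)

adjacent-<⇒≤ : {x y z : Fin N} → Adjacent x y → x < z → y ≤ z
adjacent-<⇒≤ x⋖y x<z = subst (ℕ._≤ _) (sym x⋖y) x<z

<-adjacent⇒≤ : {x y z : Fin N} → Adjacent y z → x < z → x ≤ y
<-adjacent⇒≤ y⋖z x<z = ℕ.s≤s⁻¹ (subst (_ ℕ.<_) y⋖z x<z)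

module _ {a c b : Fin N} (a⋖c : Adjacent a c) (c⋖b : Adjacent c b) where

  private
    a<b : a < b
    a<b = ℕ.<-trans (adjacent⇒< a⋖c) (adjacent⇒< c⋖b)

  -- Only the pair (a, b) itself is inverted by (a b); everything strictly between a and b is c.
  transpose-increasing : {x y : Fin N} → x ≢ c → y ≢ c → ¬ (x ≡ a × y ≡ b) →
                         x < y → transpose a b x < transpose a b y
  transpose-increasing {x} {y} x≢c y≢c not-ab x<y
    with transpose-view a b x | transpose-view a b y
  ... | at-left refl _ | at-left refl _ = ⊥-elim (ℕ.<-irrefl refl x<y)
  ... | at-left refl _ | at-right refl _ = ⊥-elim (not-ab (refl , refl))
  ... | at-left refl τx | fixed _ y≢b τy =
    subst₂ _<_ (sym τx) (sym τy)
      (≤∧≢⇒< (adjacent-<⇒≤ c⋖b (≤∧≢⇒< (adjacent-<⇒≤ a⋖c x<y) (y≢c ∘ sym))) (y≢b ∘ sym))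
  ... | at-right refl τx | at-left refl τy = subst₂ _<_ (sym τx) (sym τy) a<b
  ... | at-right refl _ | at-right refl _ = ⊥-elim (ℕ.<-irrefl refl x<y)
  ... | at-right refl τx | fixed _ _ τy = subst₂ _<_ (sym τx) (sym τy) (ℕ.<-trans a<b x<y)
  ... | fixed _ _ τx | at-left refl τy = subst₂ _<_ (sym τx) (sym τy) (ℕ.<-trans x<y a<b)
  ... | fixed x≢a _ τx | at-right refl τy =
    subst₂ _<_ (sym τx) (sym τy) (≤∧≢⇒< (<-adjacent⇒≤ a⋖c (≤∧≢⇒< (<-adjacent⇒≤ c⋖b x<y) x≢c)) x≢a)
  ... | fixed _ _ τx | fixed _ _ τy = subst₂ _<_ (sym τx) (sym τy) x<y

partner-flip : (M : Matching N) {x y : Fin N} → partner M x ≡ y → partner M y ≡ x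
partner-flip M {x} refl = invol M x

IntertwinesAt : (Fin N → Fin N) → Matching N → Matching N → Fin N → Set
IntertwinesAt σ M M' x = partner M' (σ x) ≡ σ (partner M x)

Intertwines : (Fin N → Fin N) → Matching N → Matching N → Set
Intertwines σ M M' = ∀ x → IntertwinesAt σ M M' x

intertwinesAt-partner : (σ : Fin N → Fin N) (M M' : Matching N) {x : Fin N} →
  IntertwinesAt σ M M' x → IntertwinesAt σ M M' (partner M x)
intertwinesAt-partner σ M M' {x} h = begin
  partner M' (σ (partner M x))   ≡⟨ cong (partner M') h ⟨
  partner M' (partner M' (σ x))  ≡⟨ invol M' (σ x) ⟩
  σ x                            ≡⟨ cong σ (invol M x) ⟨
  σ (partner M (partner M x))    ∎
  where open ≡-Reasoning

intertwines-sym : {σ : Fin N → Fin N} {M M' : Matching N} → (∀ x → σ (σ x) ≡ x) →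
                  Intertwines σ M M' → Intertwines σ M' M
intertwines-sym {σ = σ} {M} {M'} σσ h x = begin
  partner M (σ x)               ≡⟨ σσ _ ⟨
  σ (σ (partner M (σ x)))       ≡⟨ cong σ (h (σ x)) ⟨
  σ (partner M' (σ (σ x)))      ≡⟨ cong (σ ∘ partner M') (σσ x) ⟩
  σ (partner M' x)              ∎
  where open ≡-Reasoning

-- No hypothesis is needed at the partners of a and b: intertwinesAt-partner supplies it.
intertwines-transpose : (M M' : Matching N) (a b : Fin N) →
  partner M' b ≡ transpose a b (partner M a) →
  partner M' a ≡ transpose a b (partner M b) →
  (∀ x → x ≢ a → x ≢ b → partner M x ≢ a → partner M x ≢ b → partner M' x ≡ partner M x) →
  Intertwines (transpose a b) M M'
intertwines-transpose M M' a b at-a at-b away x with transpose-view a b x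
... | at-left refl τx  = trans (cong (partner M') τx) at-a
... | at-right refl τx = trans (cong (partner M') τx) at-b
... | fixed x≢a x≢b τx with transpose-view a b (partner M x)
...   | at-left Mx≡a _ =
  subst (IntertwinesAt τ M M') (partner-flip M Mx≡a)
    (intertwinesAt-partner τ M M' (trans (cong (partner M') (transpose-left a b)) at-a))
  where τ = transpose a b
...   | at-right Mx≡b _ =
  subst (IntertwinesAt τ M M') (partner-flip M Mx≡b)
    (intertwinesAt-partner τ M M' (trans (cong (partner M') (transpose-right a b)) at-b))
  where τ = transpose a b
...   | fixed Mx≢a Mx≢b τMx =
  trans (cong (partner M') τx) (trans (away x x≢a x≢b Mx≢a Mx≢b) (sym τMx))

chord-transport : {σ : Fin N → Fin N} {M M' : Matching N} → Injective _≡_ _≡_ σ →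
  Intertwines σ M M' → ∀ u v → IsChord M u v ⇔ IsChord M' (σ u) (σ v)
chord-transport {σ = σ} σ-inj h u v = mk⇔
  (λ (Mu≡v , u≢v) → trans (h u) (cong σ Mu≡v) , u≢v ∘ σ-inj)
  (λ (M'σu≡σv , σu≢σv) → σ-inj (trans (sym (h u)) M'σu≡σv) , σu≢σv ∘ cong σ)

unmatched-transport : {σ : Fin N → Fin N} {M M' : Matching N} → Injective _≡_ _≡_ σ →
  Intertwines σ M M' → ∀ u → IsUnmatched M u ⇔ IsUnmatched M' (σ u)
unmatched-transport {σ = σ} σ-inj h u = mk⇔
  (λ Mu≡u → trans (h u) (cong σ Mu≡u))
  (λ M'σu≡σu → σ-inj (trans (sym (h u)) M'σu≡σu))

indicator : {A : Set} → Dec A → ℕ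
indicator d = if does d then 1 else 0

indicator-cong : {A B : Set} → A ⇔ B → (p : Dec A) (q : Dec B) → indicator p ≡ indicator q
indicator-cong A⇔B (yes _) (yes _) = refl
indicator-cong A⇔B (yes a) (no ¬b) = ⊥-elim (¬b (Equivalence.to A⇔B a))
indicator-cong A⇔B (no ¬a) (yes b) = ⊥-elim (¬a (Equivalence.from A⇔B b))
indicator-cong A⇔B (no _) (no _)   = refl

length-filter-tabulate : {A : Set} {P : A → Set} (P? : Decidable P) (f : Fin N → A) →
  length (filter P? (tabulate f)) ≡ sum (λ k → indicator (P? (f k)))
length-filter-tabulate {zero} P? f = refl
length-filter-tabulate {suc N} P? f with does (P? (f Fin.zero))
... | true  = cong suc (length-filter-tabulate P? (f ∘ Fin.suc))
... | false = length-filter-tabulate P? (f ∘ Fin.suc)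

numUnmatched≡sum : (M : Matching N) → numUnmatched M ≡ sum (λ x → indicator (partner M x ≟ x))
numUnmatched≡sum M = length-filter-tabulate (λ x → partner M x ≟ x) id

numUnmatched-invariant : (π : Permutation′ N) {M M' : Matching N} →
  Intertwines (π ⟨$⟩ʳ_) M M' → numUnmatched M ≡ numUnmatched M'
numUnmatched-invariant π {M} {M'} h = begin
  numUnmatched M                                          ≡⟨ numUnmatched≡sum M ⟩
  sum (λ x → indicator (partner M x ≟ x))                 ≡⟨ sum-cong-≗ same-indicator ⟩
  sum (λ x → indicator (partner M' (π ⟨$⟩ʳ x) ≟ π ⟨$⟩ʳ x)) ≡⟨ sum-permute _ π ⟨
  sum (λ y → indicator (partner M' y ≟ y))                ≡⟨ numUnmatched≡sum M' ⟨
  numUnmatched M'                                         ∎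
  where
    open ≡-Reasoning
    π-injective : Injective _≡_ _≡_ (π ⟨$⟩ʳ_)
    π-injective πx≡πy = trans (sym (inverseˡ π)) (trans (cong (π ⟨$⟩ˡ_) πx≡πy) (inverseˡ π))
    same-indicator : ∀ x →
      indicator (partner M x ≟ x) ≡ indicator (partner M' (π ⟨$⟩ʳ x) ≟ π ⟨$⟩ʳ x)
    same-indicator x = indicator-cong (unmatched-transport {M = M} {M'} π-injective h x)
                         (partner M x ≟ x) (partner M' (π ⟨$⟩ʳ x) ≟ π ⟨$⟩ʳ x)

Increasing : (Fin K → Fin N) → Set
Increasing e = ∀ j j' → j < j' → e j < e j'

IsOccurrence : Matching K → Matching N → (Fin K → Fin N) → Set
IsOccurrence m M e =
  Increasing e
  × (∀ j j' → j < j' → IsChord m j j' ⇔ IsChord M (e j) (e j'))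
  × (∀ j → IsUnmatched m j ⇔ IsUnmatched M (e j))

occurrence-transport : {σ : Fin N → Fin N} {m : Matching K} {M M' : Matching N}
  {e : Fin K → Fin N} → Injective _≡_ _≡_ σ → Intertwines σ M M' →
  IsOccurrence m M e → Increasing (σ ∘ e) →
  IsOccurrence m M' (σ ∘ e)
occurrence-transport {σ = σ} {M = M} {M'} σ-inj h (_ , chords , unmatched) σe-increasing =
    σe-increasing
  , (λ j j' j<j' → chord-transport {σ = σ} {M} {M'} σ-inj h _ _ ⇔-∘ chords j j' j<j')
  , (λ j → unmatched-transport {σ = σ} {M} {M'} σ-inj h _ ⇔-∘ unmatched j)

occurrence-partner : {m : Matching K} {M : Matching N} {e : Fin K → Fin N} →
  IsOccurrence m M e → ∀ j → partner M (e j) ≡ e (partner m j)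
occurrence-partner {m = m} {M} {e} (_ , chords , unmatched) j with <-cmp j (partner m j)
... | tri< j<mj _ _ = proj₁ (Equivalence.to (chords j (partner m j) j<mj) (refl , j≢mj))
  where j≢mj = λ j≡mj → ℕ.<-irrefl (cong toℕ j≡mj) j<mj
... | tri≈ _ j≡mj _ = trans (Equivalence.to (unmatched j) (sym j≡mj)) (cong e j≡mj)
... | tri> _ _ mj<j =
  partner-flip M (proj₁ (Equivalence.to (chords (partner m j) j mj<j) (invol m j , mj≢j)))
  where mj≢j = λ mj≡j → ℕ.<-irrefl (cong toℕ mj≡j) mj<j

increasing-reflects-adjacency : {e : Fin K → Fin N} → Increasing e →
  ∀ {j j'} → Adjacent (e j) (e j') → Adjacent j j'
increasing-reflects-adjacency {K} {e = e} increasing {j} {j'} ej⋖ej' with <-cmp j j'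
... | tri≈ _ refl _ = ⊥-elim (adjacent⇒≢ ej⋖ej' refl)
... | tri> _ _ j'<j = ⊥-elim (ℕ.<-asym (adjacent⇒< ej⋖ej') (increasing j' j j'<j))
... | tri< j<j' _ _ with ℕ.m≤n⇒m<n∨m≡n j<j'
...   | inj₂ j⋖j' = sym j⋖j'
...   | inj₁ 1+j<j' =
  ⊥-elim (ℕ.<⇒≱ (increasing k j' k<j') (adjacent-<⇒≤ ej⋖ej' (increasing j k j<k)))
  where
    1+j<K : suc (toℕ j) ℕ.< K
    1+j<K = ℕ.<-trans 1+j<j' (toℕ<n j')
    k = fromℕ< 1+j<K
    j<k : j < k
    j<k = ℕ.≤-reflexive (sym (toℕ-fromℕ< 1+j<K))
    k<j' : k < j'
    k<j' = subst (ℕ._< toℕ j') (sym (toℕ-fromℕ< 1+j<K)) 1+j<j'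

OnShortChord : Matching N → Fin N → Set
OnShortChord M x = Adjacent x (partner M x) ⊎ Adjacent (partner M x) x

onShortChord-partner : (M : Matching N) {x : Fin N} →
  OnShortChord M x → OnShortChord M (partner M x)
onShortChord-partner M {x} (inj₁ x⋖Mx) =
  inj₂ (subst (λ y → Adjacent y (partner M x)) (sym (invol M x)) x⋖Mx)
onShortChord-partner M {x} (inj₂ Mx⋖x) =
  inj₁ (subst (Adjacent (partner M x)) (sym (invol M x)) Mx⋖x)

occurrence-avoids-short-chords : {m : Matching K} {M : Matching N} {e : Fin K → Fin N} →
  ShortEmpty m → IsOccurrence m M e → ∀ {x} → OnShortChord M x → ∀ j → e j ≢ x
occurrence-avoids-short-chords {m = m} {M} {e} short-free occ (inj₁ x⋖Mx) j refl =
  short-free j (partner m j) j⋖mj (refl , adjacent⇒≢ j⋖mj)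
  where
    j⋖mj : Adjacent j (partner m j)
    j⋖mj = increasing-reflects-adjacency (proj₁ occ)
             (subst (Adjacent (e j)) (occurrence-partner {m = m} {M} occ j) x⋖Mx)
occurrence-avoids-short-chords {m = m} {M} {e} short-free occ (inj₂ Mx⋖x) j refl =
  short-free (partner m j) j mj⋖j (invol m j , adjacent⇒≢ mj⋖j)
  where
    mj⋖j : Adjacent (partner m j) j
    mj⋖j = increasing-reflects-adjacency (proj₁ occ)
             (subst (λ y → Adjacent y (e j)) (occurrence-partner {m = m} {M} occ j) Mx⋖x)

record WindowSwap (M M' : Matching N) : Set where
  field
    a c b          : Fin N
    a⋖c            : Adjacent a c
    c⋖b            : Adjacent c b
    middle-matched : partner M c ≡ a ⊎ partner M c ≡ b
    intertwines    : Intertwines (transpose a b) M M'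

  transpose-fixes-middle : transpose a b c ≡ c
  transpose-fixes-middle = transpose-other a b (adjacent⇒≢ a⋖c ∘ sym) (adjacent⇒≢ c⋖b)

  middle-on-short-chord : OnShortChord M c
  middle-on-short-chord with middle-matched
  ... | inj₁ Mc≡a = inj₂ (subst (λ y → Adjacent y c) (sym Mc≡a) a⋖c)
  ... | inj₂ Mc≡b = inj₁ (subst (Adjacent c) (sym Mc≡b) c⋖b)

windowSwap-sym : {M M' : Matching N} → WindowSwap M M' → WindowSwap M' M
windowSwap-sym {M = M} {M'} w = record
  { a = a ; c = c ; b = b ; a⋖c = a⋖c ; c⋖b = c⋖b
  ; middle-matched = middle-matched′ middle-matched
  ; intertwines = intertwines-sym {M = M} {M'} (transpose-involutive a b) intertwines
  }
  where
    open WindowSwap w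
    M'c≡τMc : partner M' c ≡ transpose a b (partner M c)
    M'c≡τMc = trans (cong (partner M') (sym transpose-fixes-middle)) (intertwines c)
    middle-matched′ : partner M c ≡ a ⊎ partner M c ≡ b → partner M' c ≡ a ⊎ partner M' c ≡ b
    middle-matched′ (inj₁ Mc≡a) =
      inj₂ (trans M'c≡τMc (trans (cong (transpose a b) Mc≡a) (transpose-left a b)))
    middle-matched′ (inj₂ Mc≡b) =
      inj₁ (trans M'c≡τMc (trans (cong (transpose a b) Mc≡b) (transpose-right a b)))

windowSwap-transports-occurrence : {m : Matching K} {M M' : Matching N} →
  ShortEmpty m → WindowSwap M M' → Contains M m → Contains M' m
windowSwap-transports-occurrence {m = m} {M} {M'} short-free w (e , occ) =
  transpose a b ∘ e ,
  occurrence-transport {σ = transpose a b} {m = m} {M} {M'}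
    (involutive⇒injective (transpose-involutive a b)) intertwines occ τe-increasing
  where
    open WindowSwap w
    avoids : ∀ {x} → OnShortChord M x → ∀ j → e j ≢ x
    avoids = occurrence-avoids-short-chords {m = m} {M} short-free occ
    partner-on-short-chord : OnShortChord M (partner M c)
    partner-on-short-chord = onShortChord-partner M middle-on-short-chord
    not-both-ends : ∀ j j' → ¬ (e j ≡ a × e j' ≡ b)
    not-both-ends j j' (ej≡a , ej'≡b) with middle-matched
    ... | inj₁ Mc≡a = avoids partner-on-short-chord j (trans ej≡a (sym Mc≡a))
    ... | inj₂ Mc≡b = avoids partner-on-short-chord j' (trans ej'≡b (sym Mc≡b))
    τe-increasing : Increasing (transpose a b ∘ e)
    τe-increasing j j' j<j' =
      transpose-increasing a⋖c c⋖b
        (avoids middle-on-short-chord j) (avoids middle-on-short-chord j')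
        (not-both-ends j j') (proj₁ occ j j' j<j')

windowSwap-preserves-avoidance : {m : Matching K} → ShortEmpty m → ∀ f {M M' : Matching N} →
  WindowSwap M M' → InAvoidSet m f M ⇔ InAvoidSet m f M'
windowSwap-preserves-avoidance {m = m} short-free f {M} {M'} w = mk⇔
  (λ (count , avoids) → trans (sym same-count) count , avoids ∘ transport (windowSwap-sym w))
  (λ (count , avoids) → trans same-count count , avoids ∘ transport w)
  where
    open WindowSwap w
    same-count = numUnmatched-invariant (Permutation.transpose a b) {M} {M'} intertwines
    transport : {M M' : Matching _} → WindowSwap M M' → Contains M m → Contains M' m
    transport = windowSwap-transports-occurrence {m = m} short-free

-- Both moves shift a short chord (i,i+1) of M to the short chord (i+1,i+2) of M'.
windowSwap-intro : {M M' : Matching N} {i i₁ i₂ : Fin N} → Adjacent i i₁ → Adjacent i₁ i₂ →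
  partner M i ≡ i₁ → partner M' i₁ ≡ i₂ → partner M' i ≡ transpose i i₂ (partner M i₂) →
  (∀ x → x ≢ i → x ≢ i₁ → x ≢ i₂ → partner M x ≢ i₂ → partner M' x ≡ partner M x) →
  WindowSwap M M'
windowSwap-intro {M = M} {M'} {i} {i₁} {i₂} i⋖i₁ i₁⋖i₂ Mi≡i₁ M'i₁≡i₂ at-i₂ frame = record
  { a = i ; c = i₁ ; b = i₂ ; a⋖c = i⋖i₁ ; c⋖b = i₁⋖i₂
  ; middle-matched = inj₁ (partner-flip M Mi≡i₁)
  ; intertwines = intertwines-transpose M M' i i₂ at-i at-i₂ away
  }
  where
    open ≡-Reasoning
    τ = transpose i i₂
    at-i : partner M' i₂ ≡ τ (partner M i)
    at-i = begin
      partner M' i₂     ≡⟨ partner-flip M' M'i₁≡i₂ ⟩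
      i₁                ≡⟨ transpose-other i i₂ (adjacent⇒≢ i⋖i₁ ∘ sym) (adjacent⇒≢ i₁⋖i₂) ⟨
      τ i₁              ≡⟨ cong τ Mi≡i₁ ⟨
      τ (partner M i)   ∎
    away : ∀ x → x ≢ i → x ≢ i₂ → partner M x ≢ i → partner M x ≢ i₂ → partner M' x ≡ partner M x
    away x x≢i x≢i₂ Mx≢i Mx≢i₂ = frame x x≢i x≢i₁ x≢i₂ Mx≢i₂
      where
        x≢i₁ : x ≢ i₁
        x≢i₁ refl = Mx≢i (partner-flip M Mi≡i₁)

knuthA⇒windowSwap : {M M' : Matching N} → KnuthA M M' → WindowSwap M M'
knuthA⇒windowSwap {M = M} {M'}
  (i , i₁ , i₂ , i⋖i₁ , i₁⋖i₂ , (Mi≡i₁ , _) , Mi₂≡i₂ , M'i≡i , (M'i₁≡i₂ , _) , frame) =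
  windowSwap-intro i⋖i₁ i₁⋖i₂ Mi≡i₁ M'i₁≡i₂ at-i₂ (λ x x≢i x≢i₁ x≢i₂ _ → frame x x≢i x≢i₁ x≢i₂)
  where
    open ≡-Reasoning
    τ = transpose i i₂
    at-i₂ : partner M' i ≡ τ (partner M i₂)
    at-i₂ = begin
      partner M' i      ≡⟨ M'i≡i ⟩
      i                 ≡⟨ transpose-right i i₂ ⟨
      τ i₂              ≡⟨ cong τ Mi₂≡i₂ ⟨
      τ (partner M i₂)  ∎

knuthB⇒windowSwap : {M M' : Matching N} → KnuthB M M' → WindowSwap M M'
knuthB⇒windowSwap {M = M} {M'}
  (i , i₁ , i₂ , j , i⋖i₁ , i₁⋖i₂ , (Mi≡i₁ , _) , (Mi₂≡j , i₂≢j) , (M'i≡j , _) , (M'i₁≡i₂ , _) , frame) =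
  windowSwap-intro i⋖i₁ i₁⋖i₂ Mi≡i₁ M'i₁≡i₂ at-i₂ away
  where
    open ≡-Reasoning
    τ = transpose i i₂
    j≢i : j ≢ i
    j≢i refl = adjacent⇒≢ i₁⋖i₂ (trans (sym Mi≡i₁) (partner-flip M Mi₂≡j))
    at-i₂ : partner M' i ≡ τ (partner M i₂)
    at-i₂ = begin
      partner M' i      ≡⟨ M'i≡j ⟩
      j                 ≡⟨ transpose-other i i₂ j≢i (i₂≢j ∘ sym) ⟨
      τ j               ≡⟨ cong τ Mi₂≡j ⟨
      τ (partner M i₂)  ∎
    away : ∀ x → x ≢ i → x ≢ i₁ → x ≢ i₂ → partner M x ≢ i₂ → partner M' x ≡ partner M x
    away x x≢i x≢i₁ x≢i₂ Mx≢i₂ = frame x x≢i x≢i₁ x≢i₂ x≢j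
      where
        x≢j : x ≢ j
        x≢j refl = Mx≢i₂ (partner-flip M Mi₂≡j)

knuthStep⇒windowSwap : {M M' : Matching N} → KnuthStep M M' → WindowSwap M M'
knuthStep⇒windowSwap (inj₁ step)                = knuthA⇒windowSwap step
knuthStep⇒windowSwap (inj₂ (inj₁ step))         = windowSwap-sym (knuthA⇒windowSwap step)
knuthStep⇒windowSwap (inj₂ (inj₂ (inj₁ step)))  = knuthB⇒windowSwap step
knuthStep⇒windowSwap (inj₂ (inj₂ (inj₂ step)))  = windowSwap-sym (knuthB⇒windowSwap step)

lemma5p16 : ∀ {N} (m : Matching N) → ShortEmpty m →
    ∀ (N' f' : ℕ) (m₁ m₂ : Matching N') →
    KnuthEquiv m₁ m₂ → InAvoidSet m f' m₁ → InAvoidSet m f' m₂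
lemma5p16 m short-free N' f' m₁ m₂ m₁≈m₂ =
  Equivalence.to
    (gfold ⇔-isEquivalence (InAvoidSet m f') (λ {M} {M'} → step-preserves {M} {M'}) m₁≈m₂)
  where
    step-preserves : {M M' : Matching N'} → KnuthStep M M' → InAvoidSet m f' M ⇔ InAvoidSet m f' M'
    step-preserves {M} {M'} step =
      windowSwap-preserves-avoidance {m = m} short-free f' (knuthStep⇒windowSwap {M = M} {M'} step)
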